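{- Let $G=(V,E)$ be a finite connected graph (multiple edges and loops allowed). Then the rational function \[ \omega_G(\beta):=\frac{\theta_G(\beta,\sqrt{ -1})}{(1-\beta)^{|E|-|V|}} \] is a polynomial in $\beta$ with integer coefficients, i.e. $\omega_G\in\mathbb{Z}[\beta]$.
   Context: The polynomials $f_n$ are defined by $f_0(x)=1$, $f_1(x)=0$, $f_{n+1}(x)=xf_n(x)+f_{n-1}(x)$. For a finite graph $G=(V,E)$, $\theta_G(\beta,\xi)=\sum_{s\subset E}\beta^{|s|}\prod_{i\in V}f_{d_i(s)}(\xi-\xi^{ -1})$, where $d_i(s)$ is the degree of node $i$ in the subgraph with edge set $s$ (a loop contributes $2$). $\theta_G(\beta,\sqrt{ -1})$ denotes the polynomial in $\beta$ obtained by substituting $\xi=\sqrt{ -1}$, so that $\xi-\xi^{ -1}=2\sqrt{ -1}$. -}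

module Defs where

open import Data.Bool using (Bool; true; false; if_then_else_)
open import Data.Nat as ℕ using (ℕ; zero; suc)
open import Data.Integer as ℤ using (ℤ; +_; -_)
open import Data.Fin using (Fin)
open import Data.Fin.Properties using () renaming (_≟_ to _≟ᶠ_)
open import Data.List using (List; []; _∷_; map; _++_; foldr; allFin)
open import Data.Vec using (Vec; []; _∷_; lookup)
open import Data.Product using (_×_; _,_; proj₁; proj₂; ∃)
open import Data.Sum using (_⊎_)
open import Relation.Binary.PropositionalEquality using (_≡_)
open import Relation.Nullary.Decidable using (⌊_⌋)
open import Relation.Binary.Construct.Closure.ReflexiveTransitive using (Star)

infix 5 _+i_
record ℤi : Set where
  constructor _+i_
  field
    re : ℤ
    im : ℤ
open ℤi public

0ᵢ 1ᵢ ι : ℤi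
0ᵢ = + 0 +i + 0
1ᵢ = + 1 +i + 0
ι  = + 0 +i + 1

_⊕_ : ℤi → ℤi → ℤi
(a +i b) ⊕ (c +i d) = (a ℤ.+ c) +i (b ℤ.+ d)

_⊗_ : ℤi → ℤi → ℤi
(a +i b) ⊗ (c +i d) = (a ℤ.* c ℤ.- b ℤ.* d) +i (a ℤ.* d ℤ.+ b ℤ.* c)

negᵢ : ℤi → ℤi
negᵢ (a +i b) = (- a) +i (- b)

-- ξ⁻¹ for ξ = √-1 is -√-1, so ξ - ξ⁻¹ = √-1 + √-1 = 2√-1
ξ-ξ⁻¹ : ℤi
ξ-ξ⁻¹ = ι ⊕ ι

f : ℕ → ℤi → ℤi
f zero x = 1ᵢ
f (suc zero) x = 0ᵢ
f (suc (suc n)) x = (x ⊗ f (suc n) x) ⊕ f n x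

-- Finite multigraphs with loops: vertex set Fin n, edge set Fin m,
-- each edge has an (unordered) pair of endpoints (equal ends = loop).

record Graph (n m : ℕ) : Set where
  field
    ends : Fin m → Fin n × Fin n
open Graph public

Adjacent : ∀ {n m} → Graph n m → Fin n → Fin n → Set
Adjacent G i j = ∃ λ k → (ends G k ≡ (i , j)) ⊎ (ends G k ≡ (j , i))

Connected : ∀ {n m} → Graph n m → Set
Connected G = ∀ i j → Star (Adjacent G) i j

-- edge subsets s ⊂ E as characteristic vectors

subsets : (m : ℕ) → List (Vec Bool m)
subsets zero = [] ∷ []
subsets (suc m) = map (false ∷_) (subsets m) ++ map (true ∷_) (subsets m)

size : ∀ {m} → Vec Bool m → ℕ
size [] = 0
size (false ∷ s) = size s
size (true ∷ s) = suc (size s)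

ind : Bool → ℕ
ind true = 1
ind false = 0

sumℕ : List ℕ → ℕ
sumℕ = foldr ℕ._+_ 0

-- degree of vertex i in the subgraph with edge set s (a loop counts 2)
degree : ∀ {n m} → Graph n m → Vec Bool m → Fin n → ℕ
degree {m = m} G s i =
  sumℕ (map (λ k → if lookup s k
                     then ind ⌊ proj₁ (ends G k) ≟ᶠ i ⌋ ℕ.+ ind ⌊ proj₂ (ends G k) ≟ᶠ i ⌋
                     else 0)
            (allFin m))

sumᵢ : List ℤi → ℤi
sumᵢ = foldr _⊕_ 0ᵢ

prodᵢ : List ℤi → ℤi
prodᵢ = foldr _⊗_ 1ᵢ

-- Polynomials in β, represented by their coefficient sequences ℕ → R.

-- θ_G(β, √-1): coefficient of β^k
θ-coeff : ∀ {n m} → Graph n m → ℕ → ℤi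
θ-coeff {n} {m} G k =
  sumᵢ (map (λ s → if ⌊ size s ℕ.≟ k ⌋
                     then prodᵢ (map (λ i → f (degree G s i) ξ-ξ⁻¹) (allFin n))
                     else 0ᵢ)
            (subsets m))

oneMinusβ : (ℕ → ℤi) → (ℕ → ℤi)
oneMinusβ p zero = p zero
oneMinusβ p (suc k) = p (suc k) ⊕ negᵢ (p k)

oneMinusβ^ : ℕ → (ℕ → ℤi) → (ℕ → ℤi)
oneMinusβ^ zero p = p
oneMinusβ^ (suc e) p = oneMinusβ (oneMinusβ^ e p)

ℤpoly : List ℤ → ℕ → ℤi
ℤpoly [] k = 0ᵢ
ℤpoly (a ∷ as) zero = a +i + 0
ℤpoly (a ∷ as) (suc k) = ℤpoly as k

module Submission where

open import Defs
open import Data.Nat using (ℕ)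
open import Data.Integer using (ℤ)
open import Data.List using (List)
open import Data.Product using (∃)
open import Relation.Binary.PropositionalEquality using (_≡_)

open import Algebra.Bundles using (CommutativeMonoid)
open import Data.Bool using (Bool; true; false; if_then_else_)
open import Data.Fin using (Fin) renaming (zero to fzero; suc to fsuc)
open import Data.Fin.Properties using () renaming (_≟_ to _≟ᶠ_)
open import Data.Integer using (+_; -_; _+_; _-_; _*_; 0ℤ; 1ℤ; -1ℤ; _^_)
import Data.Integer.Properties as ℤ
open import Data.Integer.Tactic.RingSolver using (solve-∀)
open import Data.List using ([]; _∷_; map; _++_; foldr; allFin; length)
import Data.List.Properties as List
open import Data.Nat as ℕ using (zero; suc)
import Data.Nat.Properties as ℕ
open import Data.Product using (_×_; _,_; proj₁; proj₂)
open import Data.Unit using (⊤; tt)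
open import Data.Vec using (Vec; []; _∷_; lookup)
open import Function using (_∘_; id; const)
open import Relation.Binary.PropositionalEquality
  using (_≗_; refl; sym; trans; cong; cong₂; subst; _→-setoid_; module ≡-Reasoning)
open import Relation.Nullary.Decidable using (⌊_⌋; isYes≗does)
import Relation.Binary.Reasoning.Setoid

-- At ξ = √-1 one has f_d(2√-1) = (1 - d) (√-1)^d, so by the handshake lemma the
-- vertex product of θ_G is (-1)^|s| P(s) with P(s) = ∏_v (1 - d_v(s)), and
-- θ_G(β, √-1) = T(P) := Σ_s (-β)^|s| P(s).  As a function of the edge indicators,
-- P is a product of |V| affine functions, hence of degree at most |V|.  Splitting
-- off one edge, P = P₀ + s_e ∂P with deg ∂P < deg P, and T(P) = (1 - β) T(P₀) - β T(∂P);
-- so by induction on |E| a function of degree at most d has T(P) divisible by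
-- (1 - β)^(|E| - d).  (For a monomial ∏_{e ∈ S} s_e, T = (-β)^|S| (1 - β)^(|E| - |S|).)

module ListSum {c ℓ} (M : CommutativeMonoid c ℓ) where
  open CommutativeMonoid M renaming (refl to ≈-refl; sym to ≈-sym; trans to ≈-trans)
  open import Algebra.Properties.CommutativeSemigroup commutativeSemigroup using (interchange)

  Σ : List Carrier → Carrier
  Σ = foldr _∙_ ε

  Σ-++ : ∀ xs ys → Σ (xs ++ ys) ≈ Σ xs ∙ Σ ys
  Σ-++ [] ys = ≈-sym (identityˡ (Σ ys))
  Σ-++ (x ∷ xs) ys = ≈-trans (∙-congˡ (Σ-++ xs ys)) (≈-sym (assoc x (Σ xs) (Σ ys)))

  Σ-map-ε : ∀ {A : Set} (xs : List A) → Σ (map (const ε) xs) ≈ ε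
  Σ-map-ε [] = ≈-refl
  Σ-map-ε (x ∷ xs) = ≈-trans (identityˡ _) (Σ-map-ε xs)

  Σ-map-∙ : ∀ {A : Set} (g h : A → Carrier) xs →
            Σ (map (λ x → g x ∙ h x) xs) ≈ Σ (map g xs) ∙ Σ (map h xs)
  Σ-map-∙ g h [] = ≈-sym (identityˡ ε)
  Σ-map-∙ g h (x ∷ xs) = ≈-trans (∙-congˡ (Σ-map-∙ g h xs)) (interchange (g x) (h x) _ _)

open ListSum ℕ.+-0-commutativeMonoid using ()
  renaming (Σ-map-ε to sumℕ-map-0; Σ-map-∙ to sumℕ-map-+)
open ListSum ℤ.+-0-commutativeMonoid using ()
  renaming (Σ to sumℤ; Σ-++ to sumℤ-++; Σ-map-ε to sumℤ-map-0; Σ-map-∙ to sumℤ-map-+)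

sumℤ-map-neg : ∀ xs → sumℤ (map -_ xs) ≡ - sumℤ xs
sumℤ-map-neg xs = trans (List.foldr-map _+_ -_ 0ℤ xs)
                        (sym (List.foldr-fusion -_ 0ℤ ℤ.neg-distrib-+ xs))

prodℤ : List ℤ → ℤ
prodℤ = foldr _*_ 1ℤ

map-allFin-suc : ∀ {A : Set} {n} (g : Fin (suc n) → A) →
                 map g (allFin (suc n)) ≡ g fzero ∷ map (g ∘ fsuc) (allFin n)
map-allFin-suc g =
  cong (g fzero ∷_) (trans (List.map-tabulate fsuc g) (sym (List.map-tabulate id (g ∘ fsuc))))

-- Coefficient sequences: multiplying a power series by 1 - β is the backward difference ∇

Seq : Set
Seq = ℕ → ℤ

module ≗-Reasoning = Relation.Binary.Reasoning.Setoid (ℕ →-setoid ℤ)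

infix  8 β*_
infixl 6 _⊟_

β*_ : Seq → Seq
(β* a) zero = 0ℤ
(β* a) (suc k) = a k

_⊟_ : Seq → Seq → Seq
(a ⊟ b) k = a k - b k

∇ : Seq → Seq
∇ a = a ⊟ β* a

∇^ : ℕ → Seq → Seq
∇^ zero = id
∇^ (suc e) = ∇ ∘ ∇^ e

β*-cong : ∀ {a b} → a ≗ b → β* a ≗ β* b
β*-cong a≗b zero = refl
β*-cong a≗b (suc k) = a≗b k

⊟-cong : ∀ {a b c d} → a ≗ b → c ≗ d → a ⊟ c ≗ b ⊟ d
⊟-cong a≗b c≗d k = cong₂ _-_ (a≗b k) (c≗d k)

⊟-congˡ : ∀ a {c d} → c ≗ d → a ⊟ c ≗ a ⊟ d
⊟-congˡ a c≗d k = cong (λ x → a k - x) (c≗d k)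

∇-cong : ∀ {a b} → a ≗ b → ∇ a ≗ ∇ b
∇-cong a≗b = ⊟-cong a≗b (β*-cong a≗b)

∇^-cong : ∀ e {a b} → a ≗ b → ∇^ e a ≗ ∇^ e b
∇^-cong zero a≗b = a≗b
∇^-cong (suc e) a≗b = ∇-cong (∇^-cong e a≗b)

[x-y]-[z-w]≡[x-z]-[y-w] : ∀ x y z w → (x - y) - (z - w) ≡ (x - z) - (y - w)
[x-y]-[z-w]≡[x-z]-[y-w] = solve-∀

∇-⊟ : ∀ a b → ∇ (a ⊟ b) ≗ ∇ a ⊟ ∇ b
∇-⊟ a b zero = [x-y]-[z-w]≡[x-z]-[y-w] (a 0) (b 0) 0ℤ 0ℤ
∇-⊟ a b (suc k) = [x-y]-[z-w]≡[x-z]-[y-w] (a (suc k)) (b (suc k)) (a k) (b k)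

∇-β* : ∀ a → ∇ (β* a) ≗ β* ∇ a
∇-β* a zero = refl
∇-β* a (suc zero) = refl
∇-β* a (suc (suc k)) = refl

∇^-⊟ : ∀ e a b → ∇^ e (a ⊟ b) ≗ ∇^ e a ⊟ ∇^ e b
∇^-⊟ zero a b k = refl
∇^-⊟ (suc e) a b k = trans (∇-cong (∇^-⊟ e a b) k) (∇-⊟ (∇^ e a) (∇^ e b) k)

∇^-β* : ∀ e a → ∇^ e (β* a) ≗ β* ∇^ e a
∇^-β* zero a k = refl
∇^-β* (suc e) a k = trans (∇-cong (∇^-β* e a) k) (∇-β* (∇^ e a) k)

∇^-∇ : ∀ e a → ∇^ e (∇ a) ≗ ∇ (∇^ e a)
∇^-∇ zero a k = refl
∇^-∇ (suc e) a = ∇-cong (∇^-∇ e a)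

⟦_⟧ : List ℤ → Seq
⟦ [] ⟧ k = 0ℤ
⟦ a ∷ p ⟧ zero = a
⟦ a ∷ p ⟧ (suc k) = ⟦ p ⟧ k

infixl 6 _-ₚ_

_-ₚ_ : List ℤ → List ℤ → List ℤ
[] -ₚ q = map -_ q
(a ∷ p) -ₚ [] = a ∷ p
(a ∷ p) -ₚ (b ∷ q) = a - b ∷ p -ₚ q

∇ₚ^ : ℕ → List ℤ → List ℤ
∇ₚ^ zero p = p
∇ₚ^ (suc e) p = ∇ₚ^ e p -ₚ (0ℤ ∷ ∇ₚ^ e p)

⟦map-neg⟧ : ∀ q → ⟦ map -_ q ⟧ ≗ -_ ∘ ⟦ q ⟧
⟦map-neg⟧ [] k = refl
⟦map-neg⟧ (b ∷ q) zero = refl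
⟦map-neg⟧ (b ∷ q) (suc k) = ⟦map-neg⟧ q k

⟦-ₚ⟧ : ∀ p q → ⟦ p -ₚ q ⟧ ≗ ⟦ p ⟧ ⊟ ⟦ q ⟧
⟦-ₚ⟧ [] q k = trans (⟦map-neg⟧ q k) (sym (ℤ.+-identityˡ (- ⟦ q ⟧ k)))
⟦-ₚ⟧ (a ∷ p) [] k = sym (ℤ.+-identityʳ (⟦ a ∷ p ⟧ k))
⟦-ₚ⟧ (a ∷ p) (b ∷ q) zero = refl
⟦-ₚ⟧ (a ∷ p) (b ∷ q) (suc k) = ⟦-ₚ⟧ p q k

⟦0∷⟧ : ∀ p → ⟦ 0ℤ ∷ p ⟧ ≗ β* ⟦ p ⟧
⟦0∷⟧ p zero = refl
⟦0∷⟧ p (suc k) = refl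

⟦∇ₚ^⟧ : ∀ e p → ⟦ ∇ₚ^ e p ⟧ ≗ ∇^ e ⟦ p ⟧
⟦∇ₚ^⟧ zero p k = refl
⟦∇ₚ^⟧ (suc e) p = begin
  ⟦ q -ₚ (0ℤ ∷ q) ⟧      ≈⟨ ⟦-ₚ⟧ q (0ℤ ∷ q) ⟩
  ⟦ q ⟧ ⊟ ⟦ 0ℤ ∷ q ⟧     ≈⟨ ⊟-congˡ ⟦ q ⟧ (⟦0∷⟧ q) ⟩
  ∇ ⟦ q ⟧                ≈⟨ ∇-cong (⟦∇ₚ^⟧ e p) ⟩
  ∇ (∇^ e ⟦ p ⟧)         ∎
  where
  open ≗-Reasoning
  q : List ℤ
  q = ∇ₚ^ e p

-- Degree of a function on the Boolean cube, via discrete partial derivatives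

CubeFn : ℕ → Set
CubeFn m = Vec Bool m → ℤ

restrict₀ restrict₁ ∂ : ∀ {m} → CubeFn (suc m) → CubeFn m
restrict₀ P s = P (false ∷ s)
restrict₁ P s = P (true ∷ s)
∂ P s = restrict₁ P s - restrict₀ P s

restrict₁≗restrict₀+∂ : ∀ {m} (P : CubeFn (suc m)) → restrict₁ P ≗ λ s → restrict₀ P s + ∂ P s
restrict₁≗restrict₀+∂ P s = sym (x+[y-x]≡y (restrict₀ P s) (restrict₁ P s))
  where
  x+[y-x]≡y : ∀ x y → x + (y - x) ≡ y
  x+[y-x]≡y = solve-∀

Deg≤ : ∀ {m} → ℕ → CubeFn m → Set
Deg≤ {zero} _ _ = ⊤
Deg≤ {suc m} zero P = Deg≤ zero (restrict₀ P) × restrict₁ P ≗ restrict₀ P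
Deg≤ {suc m} (suc d) P = Deg≤ (suc d) (restrict₀ P) × Deg≤ d (∂ P)

Deg≤-cong : ∀ {m} d {P Q : CubeFn m} → P ≗ Q → Deg≤ d P → Deg≤ d Q
Deg≤-cong {zero} d P≗Q _ = tt
Deg≤-cong {suc m} zero P≗Q (hP₀ , P₁≗P₀) =
  Deg≤-cong zero (P≗Q ∘ (false ∷_)) hP₀ ,
  λ s → trans (sym (P≗Q (true ∷ s))) (trans (P₁≗P₀ s) (P≗Q (false ∷ s)))
Deg≤-cong {suc m} (suc d) P≗Q (hP₀ , h∂P) =
  Deg≤-cong (suc d) (P≗Q ∘ (false ∷_)) hP₀ ,
  Deg≤-cong d (λ s → cong₂ _-_ (P≗Q (true ∷ s)) (P≗Q (false ∷ s))) h∂P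

Deg≤-const : ∀ {m} d (c : ℤ) → Deg≤ {m} d (const c)
Deg≤-const {zero} d c = tt
Deg≤-const {suc m} zero c = Deg≤-const zero c , λ _ → refl
Deg≤-const {suc m} (suc d) c =
  Deg≤-const (suc d) c , Deg≤-cong d (λ _ → sym (ℤ.+-inverseʳ c)) (Deg≤-const d 0ℤ)

Deg≤-suc : ∀ {m} d {P : CubeFn m} → Deg≤ d P → Deg≤ (suc d) P
Deg≤-suc {zero} d _ = tt
Deg≤-suc {suc m} zero {P} (hP₀ , P₁≗P₀) =
  Deg≤-suc zero hP₀ , Deg≤-cong zero 0≡∂P (Deg≤-const zero 0ℤ)
  where
  0≡∂P : ∀ s → 0ℤ ≡ ∂ P s
  0≡∂P s = trans (sym (ℤ.+-inverseʳ (restrict₀ P s))) (cong (_- restrict₀ P s) (sym (P₁≗P₀ s)))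
Deg≤-suc {suc m} (suc d) (hP₀ , h∂P) = Deg≤-suc (suc d) hP₀ , Deg≤-suc d h∂P

Deg≤-+ : ∀ {m} d {P Q : CubeFn m} → Deg≤ d P → Deg≤ d Q → Deg≤ d (λ s → P s + Q s)
Deg≤-+ {zero} d _ _ = tt
Deg≤-+ {suc m} zero (hP₀ , P₁≗P₀) (hQ₀ , Q₁≗Q₀) =
  Deg≤-+ zero hP₀ hQ₀ , λ s → cong₂ _+_ (P₁≗P₀ s) (Q₁≗Q₀ s)
Deg≤-+ {suc m} (suc d) {P} {Q} (hP₀ , h∂P) (hQ₀ , h∂Q) =
  Deg≤-+ (suc d) hP₀ hQ₀ ,
  Deg≤-cong d (λ s → ∂-+ (restrict₁ P s) (restrict₀ P s) (restrict₁ Q s) (restrict₀ Q s))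
    (Deg≤-+ d h∂P h∂Q)
  where
  ∂-+ : ∀ x₁ x₀ y₁ y₀ → (x₁ - x₀) + (y₁ - y₀) ≡ (x₁ + y₁) - (x₀ + y₀)
  ∂-+ = solve-∀

Deg≤-* : ∀ {m} d e {P Q : CubeFn m} → Deg≤ d P → Deg≤ e Q → Deg≤ (d ℕ.+ e) (λ s → P s * Q s)
Deg≤-* {zero} d e _ _ = tt
Deg≤-* {suc m} zero zero (hP₀ , P₁≗P₀) (hQ₀ , Q₁≗Q₀) =
  Deg≤-* zero zero hP₀ hQ₀ , λ s → cong₂ _*_ (P₁≗P₀ s) (Q₁≗Q₀ s)
Deg≤-* {suc m} zero (suc e) {P} {Q} (hP₀ , P₁≗P₀) (hQ₀ , h∂Q) =
  Deg≤-* zero (suc e) hP₀ hQ₀ , Deg≤-cong e ∂[PQ] (Deg≤-* zero e hP₀ h∂Q)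
  where
  *-distribˡ-- : ∀ x y z → x * (y - z) ≡ x * y - x * z
  *-distribˡ-- = solve-∀
  ∂[PQ] : ∀ s → restrict₀ P s * ∂ Q s ≡ ∂ (λ s → P s * Q s) s
  ∂[PQ] s = trans (*-distribˡ-- (restrict₀ P s) (restrict₁ Q s) (restrict₀ Q s))
                  (cong (λ x → x * restrict₁ Q s - restrict₀ P s * restrict₀ Q s) (sym (P₁≗P₀ s)))
Deg≤-* {suc m} (suc d) zero {P} {Q} (hP₀ , h∂P) (hQ₀ , Q₁≗Q₀) =
  Deg≤-* (suc d) zero hP₀ hQ₀ , Deg≤-cong (d ℕ.+ zero) ∂[PQ] (Deg≤-* d zero h∂P hQ₀)
  where
  *-distribʳ-- : ∀ x y z → (y - z) * x ≡ y * x - z * x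
  *-distribʳ-- = solve-∀
  ∂[PQ] : ∀ s → ∂ P s * restrict₀ Q s ≡ ∂ (λ s → P s * Q s) s
  ∂[PQ] s = trans (*-distribʳ-- (restrict₀ Q s) (restrict₁ P s) (restrict₀ P s))
                  (cong (λ y → restrict₁ P s * y - restrict₀ P s * restrict₀ Q s) (sym (Q₁≗Q₀ s)))
Deg≤-* {suc m} (suc d) (suc e) {P} {Q} (hP₀ , h∂P) (hQ₀ , h∂Q) =
  Deg≤-* (suc d) (suc e) hP₀ hQ₀ ,
  Deg≤-cong (d ℕ.+ suc e) ∂[PQ] (Deg≤-+ (d ℕ.+ suc e) (Deg≤-* d (suc e) h∂P hQ₁) hP₀∂Q)
  where
  leibniz : ∀ x₁ x₀ y₁ y₀ → (x₁ - x₀) * y₁ + x₀ * (y₁ - y₀) ≡ x₁ * y₁ - x₀ * y₀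
  leibniz = solve-∀
  ∂[PQ] : ∀ s → ∂ P s * restrict₁ Q s + restrict₀ P s * ∂ Q s ≡ ∂ (λ s → P s * Q s) s
  ∂[PQ] s = leibniz (restrict₁ P s) (restrict₀ P s) (restrict₁ Q s) (restrict₀ Q s)
  hQ₁ : Deg≤ (suc e) (restrict₁ Q)
  hQ₁ = Deg≤-cong (suc e) (sym ∘ restrict₁≗restrict₀+∂ Q) (Deg≤-+ (suc e) hQ₀ (Deg≤-suc e h∂Q))
  hP₀∂Q : Deg≤ (d ℕ.+ suc e) (λ s → restrict₀ P s * ∂ Q s)
  hP₀∂Q = subst (λ k → Deg≤ k (λ s → restrict₀ P s * ∂ Q s)) (sym (ℕ.+-suc d e))
                (Deg≤-* (suc d) e hP₀ h∂Q)

Deg≤-prod : ∀ {m} {X : Set} (F : X → CubeFn m) (xs : List X) → (∀ x → Deg≤ 1 (F x)) →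
            Deg≤ (length xs) (λ s → prodℤ (map (λ x → F x s) xs))
Deg≤-prod F [] _ = Deg≤-const 0 1ℤ
Deg≤-prod F (x ∷ xs) hF = Deg≤-* 1 (length xs) (hF x) (Deg≤-prod F xs hF)

weight : ∀ {m} → (Fin m → ℕ) → Vec Bool m → ℕ
weight {m} c s = sumℕ (map (λ k → if lookup s k then c k else 0) (allFin m))

weight-cons : ∀ {m} (c : Fin (suc m) → ℕ) b s →
              weight c (b ∷ s) ≡ (if b then c fzero else 0) ℕ.+ weight (c ∘ fsuc) s
weight-cons c b s = cong sumℕ (map-allFin-suc (λ k → if lookup (b ∷ s) k then c k else 0))

Deg≤-affine : ∀ {m} (a : ℤ) (c : Fin m → ℕ) → Deg≤ 1 (λ s → a - + weight c s)
Deg≤-affine {zero} a c = tt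
Deg≤-affine {suc m} a c =
  Deg≤-cong 1 (λ s → cong (λ w → a - + w) (sym (weight-cons c false s)))
    (Deg≤-affine a (c ∘ fsuc)) ,
  Deg≤-cong 0 ∂-affine (Deg≤-const 0 (- + c fzero))
  where
  a-[x+w]-[a-w] : ∀ a x w → - x ≡ (a - (x + w)) - (a - w)
  a-[x+w]-[a-w] = solve-∀
  ∂-affine : ∀ s → - + c fzero ≡ (a - + weight c (true ∷ s)) - (a - + weight c (false ∷ s))
  ∂-affine s = trans (a-[x+w]-[a-w] a (+ c fzero) (+ weight (c ∘ fsuc) s))
                     (cong₂ (λ w₁ w₀ → (a - + w₁) - (a - + w₀))
                            (sym (weight-cons c true s)) (sym (weight-cons c false s)))

-- The signed generating function Σ_s (-β)^|s| P(s) of a function on the cube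

signedTerm : ∀ {m} → CubeFn m → ℕ → Vec Bool m → ℤ
signedTerm P k s = if ⌊ size s ℕ.≟ k ⌋ then -1ℤ ^ size s * P s else 0ℤ

signedGF : ∀ {m} → CubeFn m → Seq
signedGF {m} P k = sumℤ (map (signedTerm P k) (subsets m))

≟-suc : ∀ a b → ⌊ suc a ℕ.≟ suc b ⌋ ≡ ⌊ a ℕ.≟ b ⌋
≟-suc a b = trans (isYes≗does (suc a ℕ.≟ suc b)) (sym (isYes≗does (a ℕ.≟ b)))

signedTerm-true : ∀ {m} (P : CubeFn (suc m)) k s →
                  signedTerm P (suc k) (true ∷ s) ≡ - signedTerm (restrict₁ P) k s
signedTerm-true P k s rewrite ≟-suc (size s) k with ⌊ size s ℕ.≟ k ⌋
... | true  = trans (ℤ.*-assoc -1ℤ (-1ℤ ^ size s) (P (true ∷ s))) (ℤ.-1*i≡-i _)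
... | false = refl

signedTerm-+ : ∀ {m} (P Q : CubeFn m) k s →
               signedTerm (λ s → P s + Q s) k s ≡ signedTerm P k s + signedTerm Q k s
signedTerm-+ P Q k s with ⌊ size s ℕ.≟ k ⌋
... | true  = ℤ.*-distribˡ-+ (-1ℤ ^ size s) (P s) (Q s)
... | false = refl

signedGF-cong : ∀ {m} {P Q : CubeFn m} → P ≗ Q → signedGF P ≗ signedGF Q
signedGF-cong {m} P≗Q k =
  cong sumℤ (List.map-cong (λ s → cong (λ x → if ⌊ size s ℕ.≟ k ⌋ then -1ℤ ^ size s * x else 0ℤ)
                                        (P≗Q s))
                           (subsets m))

signedGF-+ : ∀ {m} (P Q : CubeFn m) → signedGF (λ s → P s + Q s) ≗ λ k → signedGF P k + signedGF Q k
signedGF-+ {m} P Q k =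
  trans (cong sumℤ (List.map-cong (signedTerm-+ P Q k) (subsets m)))
        (sumℤ-map-+ (signedTerm P k) (signedTerm Q k) (subsets m))

signedGF-[] : (P : CubeFn 0) → signedGF P ≗ ⟦ P [] ∷ [] ⟧
signedGF-[] P zero = trans (ℤ.+-identityʳ (1ℤ * P [])) (ℤ.*-identityˡ (P []))
signedGF-[] P (suc k) = refl

signedGF-cons : ∀ {m} (P : CubeFn (suc m)) →
                signedGF P ≗ signedGF (restrict₀ P) ⊟ β* signedGF (restrict₁ P)
signedGF-cons {m} P k = begin
  sumℤ (map (signedTerm P k) (map (false ∷_) S ++ map (true ∷_) S))
    ≡⟨ cong sumℤ (List.map-++ (signedTerm P k) (map (false ∷_) S) (map (true ∷_) S)) ⟩
  sumℤ (map (signedTerm P k) (map (false ∷_) S) ++ map (signedTerm P k) (map (true ∷_) S))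
    ≡⟨ sumℤ-++ (map (signedTerm P k) (map (false ∷_) S)) (map (signedTerm P k) (map (true ∷_) S)) ⟩
  sumℤ (map (signedTerm P k) (map (false ∷_) S)) + sumℤ (map (signedTerm P k) (map (true ∷_) S))
    ≡⟨ cong₂ _+_ (cong sumℤ (sym (List.map-∘ S)))
                 (trans (cong sumℤ (sym (List.map-∘ S))) (true-part k)) ⟩
  signedGF (restrict₀ P) k - (β* signedGF (restrict₁ P)) k ∎
  where
  open ≡-Reasoning
  S : List (Vec Bool m)
  S = subsets m
  true-part : ∀ k → sumℤ (map (signedTerm P k ∘ (true ∷_)) S) ≡ - (β* signedGF (restrict₁ P)) k
  true-part zero = sumℤ-map-0 S
  true-part (suc k) = trans (cong sumℤ (trans (List.map-cong (signedTerm-true P k) S) (List.map-∘ S)))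
                            (sumℤ-map-neg (map (signedTerm (restrict₁ P) k) S))

signedGF-indep : ∀ {m} (P : CubeFn (suc m)) → restrict₁ P ≗ restrict₀ P →
                  signedGF P ≗ ∇ (signedGF (restrict₀ P))
signedGF-indep P P₁≗P₀ k =
  trans (signedGF-cons P k) (⊟-congˡ (signedGF (restrict₀ P)) (β*-cong (signedGF-cong P₁≗P₀)) k)

signedGF-∂ : ∀ {m} (P : CubeFn (suc m)) →
             signedGF P ≗ ∇ (signedGF (restrict₀ P)) ⊟ β* signedGF (∂ P)
signedGF-∂ P zero = trans (signedGF-cons P zero) (sym (ℤ.+-identityʳ _))
signedGF-∂ {m} P (suc k) = begin
  signedGF P (suc k)
    ≡⟨ signedGF-cons P (suc k) ⟩
  signedGF P₀ (suc k) - signedGF (restrict₁ P) k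
    ≡⟨ cong (λ x → signedGF P₀ (suc k) - x)
            (trans (signedGF-cong (restrict₁≗restrict₀+∂ P) k) (signedGF-+ P₀ (∂ P) k)) ⟩
  signedGF P₀ (suc k) - (signedGF P₀ k + signedGF (∂ P) k)
    ≡⟨ x-[y+z]≡x-y-z (signedGF P₀ (suc k)) (signedGF P₀ k) (signedGF (∂ P) k) ⟩
  signedGF P₀ (suc k) - signedGF P₀ k - signedGF (∂ P) k ∎
  where
  open ≡-Reasoning
  P₀ : CubeFn m
  P₀ = restrict₀ P
  x-[y+z]≡x-y-z : ∀ x y z → x - (y + z) ≡ x - y - z
  x-[y+z]≡x-y-z = solve-∀

Deg≤⇒signedGF-divisible : ∀ {m} d (P : CubeFn m) → Deg≤ d P →
                           ∃ λ (p : List ℤ) → ∇^ m ⟦ p ⟧ ≗ ∇^ d (signedGF P)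
Deg≤⇒signedGF-divisible {zero} d P _ =
  ∇ₚ^ d (P [] ∷ []) ,
  λ k → trans (⟦∇ₚ^⟧ d (P [] ∷ []) k) (∇^-cong d (sym ∘ signedGF-[] P) k)
Deg≤⇒signedGF-divisible {suc m} zero P (hP₀ , P₁≗P₀) =
  let p , ∇ᵐp≗P₀ = Deg≤⇒signedGF-divisible zero (restrict₀ P) hP₀
  in p , λ k → trans (∇-cong ∇ᵐp≗P₀ k) (sym (signedGF-indep P P₁≗P₀ k))
Deg≤⇒signedGF-divisible {suc m} (suc d) P (hP₀ , h∂P) =
  let p₀ , eq₀ = Deg≤⇒signedGF-divisible (suc d) (restrict₀ P) hP₀
      p₁ , eq₁ = Deg≤⇒signedGF-divisible d (∂ P) h∂P
  in p₀ -ₚ (0ℤ ∷ p₁) , (begin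
    ∇^ (suc m) ⟦ p₀ -ₚ (0ℤ ∷ p₁) ⟧
      ≈⟨ ∇^-cong (suc m) (λ k → trans (⟦-ₚ⟧ p₀ (0ℤ ∷ p₁) k) (⊟-congˡ ⟦ p₀ ⟧ (⟦0∷⟧ p₁) k)) ⟩
    ∇^ (suc m) (⟦ p₀ ⟧ ⊟ β* ⟦ p₁ ⟧)
      ≈⟨ ∇^-⊟ (suc m) ⟦ p₀ ⟧ (β* ⟦ p₁ ⟧) ⟩
    ∇ (∇^ m ⟦ p₀ ⟧) ⊟ ∇^ (suc m) (β* ⟦ p₁ ⟧)
      ≈⟨ ⊟-cong (∇-cong eq₀) (λ k → trans (∇^-β* (suc m) ⟦ p₁ ⟧ k) (β*-cong (∇-cong eq₁) k)) ⟩
    ∇ (∇^ (suc d) T₀) ⊟ β* ∇ (∇^ d T∂)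
      ≈⟨ ⊟-cong (sym ∘ ∇^-∇ (suc d) T₀) (sym ∘ ∇^-β* (suc d) T∂) ⟩
    ∇^ (suc d) (∇ T₀) ⊟ ∇^ (suc d) (β* T∂)
      ≈⟨ sym ∘ ∇^-⊟ (suc d) (∇ T₀) (β* T∂) ⟩
    ∇^ (suc d) (∇ T₀ ⊟ β* T∂)
      ≈⟨ ∇^-cong (suc d) (sym ∘ signedGF-∂ P) ⟩
    ∇^ (suc d) (signedGF P) ∎)
  where
  open ≗-Reasoning
  T₀ T∂ : Seq
  T₀ = signedGF (restrict₀ P)
  T∂ = signedGF (∂ P)

sum-weight : ∀ {m} {X : Set} (c : X → Fin m → ℕ) (xs : List X) s →
             sumℕ (map (λ x → weight (c x) s) xs) ≡ weight (λ k → sumℕ (map (λ x → c x k) xs)) s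
sum-weight c xs [] = sumℕ-map-0 xs
sum-weight {suc m} c xs (b ∷ s) = begin
  sumℕ (map (λ x → weight (c x) (b ∷ s)) xs)
    ≡⟨ cong sumℕ (List.map-cong (λ x → weight-cons (c x) b s) xs) ⟩
  sumℕ (map (λ x → (if b then c x fzero else 0) ℕ.+ weight (c x ∘ fsuc) s) xs)
    ≡⟨ sumℕ-map-+ (λ x → if b then c x fzero else 0) (λ x → weight (c x ∘ fsuc) s) xs ⟩
  sumℕ (map (λ x → if b then c x fzero else 0) xs) ℕ.+ sumℕ (map (λ x → weight (c x ∘ fsuc) s) xs)
    ≡⟨ cong₂ ℕ._+_ (sum-if b) (sum-weight (λ x → c x ∘ fsuc) xs s) ⟩
  (if b then Σc fzero else 0) ℕ.+ weight (Σc ∘ fsuc) s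
    ≡⟨ weight-cons Σc b s ⟨
  weight Σc (b ∷ s) ∎
  where
  open ≡-Reasoning
  Σc : Fin (suc m) → ℕ
  Σc k = sumℕ (map (λ x → c x k) xs)
  sum-if : ∀ b → sumℕ (map (λ x → if b then c x fzero else 0) xs) ≡ (if b then Σc fzero else 0)
  sum-if true = refl
  sum-if false = sumℕ-map-0 xs

weight-const : ∀ {m} (c : ℕ) (s : Vec Bool m) → weight (const c) s ≡ size s ℕ.* c
weight-const c [] = refl
weight-const c (false ∷ s) = trans (weight-cons (const c) false s) (weight-const c s)
weight-const c (true ∷ s) = trans (weight-cons (const c) true s) (cong (c ℕ.+_) (weight-const c s))

sum-indicator : ∀ {n} (a : Fin n) → sumℕ (map (λ v → ind ⌊ a ≟ᶠ v ⌋) (allFin n)) ≡ 1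
sum-indicator {suc n} fzero =
  trans (cong sumℕ (map-allFin-suc {n = n} (λ v → ind ⌊ fzero ≟ᶠ v ⌋)))
        (cong suc (sumℕ-map-0 (allFin n)))
sum-indicator {suc n} (fsuc a) =
  trans (cong sumℕ (map-allFin-suc {n = n} (λ v → ind ⌊ fsuc a ≟ᶠ v ⌋)))
        (trans (cong sumℕ (List.map-cong (λ v → cong ind (≟ᶠ-suc v)) (allFin n))) (sum-indicator a))
  where
  ≟ᶠ-suc : ∀ v → ⌊ fsuc a ≟ᶠ fsuc v ⌋ ≡ ⌊ a ≟ᶠ v ⌋
  ≟ᶠ-suc v = trans (isYes≗does (fsuc a ≟ᶠ fsuc v)) (sym (isYes≗does (a ≟ᶠ v)))

-- Gaussian integers

toℤi : ℤ → ℤi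
toℤi a = a +i 0ℤ

infixr 30 ι·_ ι^_
infixr 25 _·ᵢ_

ι·_ : ℤi → ℤi
ι· (a +i b) = - b +i a

ι^_ : ℕ → ℤi
ι^ zero = 1ᵢ
ι^ suc d = ι· ι^ d

_·ᵢ_ : ℤ → ℤi → ℤi
c ·ᵢ (a +i b) = c * a +i c * b

ι·-⊗ : ∀ z w → ι· (z ⊗ w) ≡ (ι· z) ⊗ w
ι·-⊗ (a +i b) (c +i d) = cong₂ _+i_ (re-eq a b c d) (im-eq a b c d)
  where
  re-eq : ∀ a b c d → - (a * d + b * c) ≡ - b * c - a * d
  re-eq = solve-∀
  im-eq : ∀ a b c d → a * c - b * d ≡ - b * d + a * c
  im-eq = solve-∀

⊗-identityˡ : ∀ w → 1ᵢ ⊗ w ≡ w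
⊗-identityˡ (c +i d) = cong₂ _+i_ (re-eq c d) (im-eq c d)
  where
  re-eq : ∀ c d → 1ℤ * c - 0ℤ * d ≡ c
  re-eq = solve-∀
  im-eq : ∀ c d → 1ℤ * d + 0ℤ * c ≡ d
  im-eq = solve-∀

·ᵢ-⊗ : ∀ x y z w → (x ·ᵢ z) ⊗ (y ·ᵢ w) ≡ (x * y) ·ᵢ (z ⊗ w)
·ᵢ-⊗ x y (a +i b) (c +i d) = cong₂ _+i_ (re-eq x y a b c d) (im-eq x y a b c d)
  where
  re-eq : ∀ x y a b c d → (x * a) * (y * c) - (x * b) * (y * d) ≡ (x * y) * (a * c - b * d)
  re-eq = solve-∀
  im-eq : ∀ x y a b c d → (x * a) * (y * d) + (x * b) * (y * c) ≡ (x * y) * (a * d + b * c)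
  im-eq = solve-∀

ι^-+ : ∀ d e → ι^ (d ℕ.+ e) ≡ ι^ d ⊗ ι^ e
ι^-+ zero e = sym (⊗-identityˡ (ι^ e))
ι^-+ (suc d) e = trans (cong ι·_ (ι^-+ d e)) (ι·-⊗ (ι^ d) (ι^ e))

ι^-*2 : ∀ k → ι^ (k ℕ.* 2) ≡ toℤi (-1ℤ ^ k)
ι^-*2 zero = refl
ι^-*2 (suc k) = trans (cong (λ z → ι· ι· z) (ι^-*2 k)) (cong toℤi (sym (ℤ.-1*i≡-i (-1ℤ ^ k))))

f-at-2ι : ∀ d → f d ξ-ξ⁻¹ ≡ (1ℤ - + d) ·ᵢ ι^ d
f-at-2ι zero = refl
f-at-2ι (suc zero) = refl
f-at-2ι (suc (suc d)) = begin
  (ξ-ξ⁻¹ ⊗ f (suc d) ξ-ξ⁻¹) ⊕ f d ξ-ξ⁻¹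
    ≡⟨ cong₂ (λ x y → (ξ-ξ⁻¹ ⊗ x) ⊕ y) (f-at-2ι (suc d)) (f-at-2ι d) ⟩
  (ξ-ξ⁻¹ ⊗ ((1ℤ - + suc d) ·ᵢ ι· ι^ d)) ⊕ ((1ℤ - + d) ·ᵢ ι^ d)
    ≡⟨ recurrence (+ d) (ι^ d) ⟩
  (1ℤ - + suc (suc d)) ·ᵢ ι· ι· ι^ d ∎
  where
  open ≡-Reasoning
  recurrence : ∀ u z → (ξ-ξ⁻¹ ⊗ ((1ℤ - (1ℤ + u)) ·ᵢ ι· z)) ⊕ ((1ℤ - u) ·ᵢ z)
                     ≡ (1ℤ - (1ℤ + (1ℤ + u))) ·ᵢ ι· ι· z
  recurrence u (a +i b) = cong₂ _+i_ (re-eq u a b) (im-eq u a b)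
    where
    re-eq : ∀ u a b → 0ℤ * ((1ℤ - (1ℤ + u)) * - b) - + 2 * ((1ℤ - (1ℤ + u)) * a) + (1ℤ - u) * a
                    ≡ (1ℤ - (1ℤ + (1ℤ + u))) * - a
    re-eq = solve-∀
    im-eq : ∀ u a b → 0ℤ * ((1ℤ - (1ℤ + u)) * a) + + 2 * ((1ℤ - (1ℤ + u)) * - b) + (1ℤ - u) * b
                    ≡ (1ℤ - (1ℤ + (1ℤ + u))) * - b
    im-eq = solve-∀

prodᵢ-·ᵢι^ : ∀ {X : Set} (a : X → ℤ) (d : X → ℕ) xs →
             prodᵢ (map (λ x → a x ·ᵢ ι^ d x) xs) ≡ prodℤ (map a xs) ·ᵢ ι^ sumℕ (map d xs)
prodᵢ-·ᵢι^ a d [] = refl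
prodᵢ-·ᵢι^ a d (x ∷ xs) = begin
  (a x ·ᵢ ι^ d x) ⊗ prodᵢ (map (λ x → a x ·ᵢ ι^ d x) xs)
    ≡⟨ cong ((a x ·ᵢ ι^ d x) ⊗_) (prodᵢ-·ᵢι^ a d xs) ⟩
  (a x ·ᵢ ι^ d x) ⊗ (prodℤ (map a xs) ·ᵢ ι^ sumℕ (map d xs))
    ≡⟨ ·ᵢ-⊗ (a x) (prodℤ (map a xs)) (ι^ d x) (ι^ sumℕ (map d xs)) ⟩
  (a x * prodℤ (map a xs)) ·ᵢ (ι^ d x ⊗ ι^ sumℕ (map d xs))
    ≡⟨ cong ((a x * prodℤ (map a xs)) ·ᵢ_) (ι^-+ (d x) (sumℕ (map d xs))) ⟨
  (a x * prodℤ (map a xs)) ·ᵢ ι^ (d x ℕ.+ sumℕ (map d xs)) ∎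
  where open ≡-Reasoning

toℤi-sumℤ : ∀ {X : Set} (h : X → ℤ) xs → sumᵢ (map (toℤi ∘ h) xs) ≡ toℤi (sumℤ (map h xs))
toℤi-sumℤ h [] = refl
toℤi-sumℤ h (x ∷ xs) = cong (toℤi (h x) ⊕_) (toℤi-sumℤ h xs)

oneMinusβ-cong : ∀ {p q : ℕ → ℤi} → p ≗ q → oneMinusβ p ≗ oneMinusβ q
oneMinusβ-cong p≗q zero = p≗q zero
oneMinusβ-cong p≗q (suc k) = cong₂ (λ x y → x ⊕ negᵢ y) (p≗q (suc k)) (p≗q k)

oneMinusβ^-cong : ∀ e {p q : ℕ → ℤi} → p ≗ q → oneMinusβ^ e p ≗ oneMinusβ^ e q
oneMinusβ^-cong zero p≗q = p≗q
oneMinusβ^-cong (suc e) p≗q = oneMinusβ-cong (oneMinusβ^-cong e p≗q)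

oneMinusβ^-toℤi : ∀ e (a : Seq) → oneMinusβ^ e (toℤi ∘ a) ≗ toℤi ∘ ∇^ e a
oneMinusβ^-toℤi zero a k = refl
oneMinusβ^-toℤi (suc e) a k =
  trans (oneMinusβ-cong (oneMinusβ^-toℤi e a) k) (oneMinusβ-toℤi (∇^ e a) k)
  where
  oneMinusβ-toℤi : ∀ b → oneMinusβ (toℤi ∘ b) ≗ toℤi ∘ ∇ b
  oneMinusβ-toℤi b zero = cong toℤi (sym (ℤ.+-identityʳ (b 0)))
  oneMinusβ-toℤi b (suc k) = refl

ℤpoly≗toℤi⟦⟧ : ∀ p → ℤpoly p ≗ toℤi ∘ ⟦ p ⟧
ℤpoly≗toℤi⟦⟧ [] k = refl
ℤpoly≗toℤi⟦⟧ (a ∷ p) zero = refl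
ℤpoly≗toℤi⟦⟧ (a ∷ p) (suc k) = ℤpoly≗toℤi⟦⟧ p k

-- Graphs

module _ {n m : ℕ} (G : Graph n m) where

  incidence : Fin n → Fin m → ℕ
  incidence v k = ind ⌊ proj₁ (ends G k) ≟ᶠ v ⌋ ℕ.+ ind ⌊ proj₂ (ends G k) ≟ᶠ v ⌋

  sum-incidence : ∀ k → sumℕ (map (λ v → incidence v k) (allFin n)) ≡ 2
  sum-incidence k =
    trans (sumℕ-map-+ (λ v → ind ⌊ proj₁ (ends G k) ≟ᶠ v ⌋) (λ v → ind ⌊ proj₂ (ends G k) ≟ᶠ v ⌋)
                      (allFin n))
          (cong₂ ℕ._+_ (sum-indicator (proj₁ (ends G k))) (sum-indicator (proj₂ (ends G k))))

  handshake : ∀ s → sumℕ (map (degree G s) (allFin n)) ≡ size s ℕ.* 2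
  handshake s = begin
    sumℕ (map (λ v → weight (incidence v) s) (allFin n))
      ≡⟨ sum-weight incidence (allFin n) s ⟩
    weight (λ k → sumℕ (map (λ v → incidence v k) (allFin n))) s
      ≡⟨ cong sumℕ (List.map-cong weight-term (allFin m)) ⟩
    weight (const 2) s
      ≡⟨ weight-const 2 s ⟩
    size s ℕ.* 2 ∎
    where
    open ≡-Reasoning
    weight-term : ∀ k → (if lookup s k then sumℕ (map (λ v → incidence v k) (allFin n)) else 0)
                      ≡ (if lookup s k then 2 else 0)
    weight-term k = cong (λ x → if lookup s k then x else 0) (sum-incidence k)

  degreeProduct : CubeFn m
  degreeProduct s = prodℤ (map (λ v → 1ℤ - + degree G s v) (allFin n))

  Deg≤-degreeProduct : Deg≤ n degreeProduct
  Deg≤-degreeProduct =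
    subst (λ d → Deg≤ d degreeProduct) (List.length-tabulate id)
      (Deg≤-prod (λ v s → 1ℤ - + degree G s v) (allFin n) (λ v → Deg≤-affine 1ℤ (incidence v)))

  vertexProduct : ∀ s → prodᵢ (map (λ v → f (degree G s v) ξ-ξ⁻¹) (allFin n))
                        ≡ toℤi (-1ℤ ^ size s * degreeProduct s)
  vertexProduct s = begin
    prodᵢ (map (λ v → f (degree G s v) ξ-ξ⁻¹) (allFin n))
      ≡⟨ cong prodᵢ (List.map-cong (f-at-2ι ∘ degree G s) (allFin n)) ⟩
    prodᵢ (map (λ v → (1ℤ - + degree G s v) ·ᵢ ι^ degree G s v) (allFin n))
      ≡⟨ prodᵢ-·ᵢι^ (λ v → 1ℤ - + degree G s v) (degree G s) (allFin n) ⟩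
    degreeProduct s ·ᵢ ι^ sumℕ (map (degree G s) (allFin n))
      ≡⟨ cong (λ d → degreeProduct s ·ᵢ ι^ d) (handshake s) ⟩
    degreeProduct s ·ᵢ ι^ (size s ℕ.* 2)
      ≡⟨ cong (degreeProduct s ·ᵢ_) (ι^-*2 (size s)) ⟩
    degreeProduct s ·ᵢ toℤi (-1ℤ ^ size s)
      ≡⟨ cong₂ _+i_ (ℤ.*-comm (degreeProduct s) (-1ℤ ^ size s)) (ℤ.*-zeroʳ (degreeProduct s)) ⟩
    toℤi (-1ℤ ^ size s * degreeProduct s) ∎
    where open ≡-Reasoning

  θ-coeff≡signedGF : ∀ k → θ-coeff G k ≡ toℤi (signedGF degreeProduct k)
  θ-coeff≡signedGF k =
    trans (cong sumᵢ (List.map-cong summand (subsets m)))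
          (toℤi-sumℤ (signedTerm degreeProduct k) (subsets m))
    where
    summand : ∀ s → (if ⌊ size s ℕ.≟ k ⌋
                       then prodᵢ (map (λ v → f (degree G s v) ξ-ξ⁻¹) (allFin n))
                       else 0ᵢ)
                    ≡ toℤi (signedTerm degreeProduct k s)
    summand s with ⌊ size s ℕ.≟ k ⌋
    ... | true  = vertexProduct s
    ... | false = refl

theorem8 : ∀ (n m : ℕ) (G : Graph n m) → Connected G →
    ∃ λ (p : List ℤ) → ∀ (k : ℕ) →
      oneMinusβ^ m (ℤpoly p) k ≡ oneMinusβ^ n (θ-coeff G) k
theorem8 n m G _ =
  let p , ∇ᵐp≗∇ⁿT = Deg≤⇒signedGF-divisible n (degreeProduct G) (Deg≤-degreeProduct G)
  in p , λ k → begin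
    oneMinusβ^ m (ℤpoly p) k                    ≡⟨ oneMinusβ^-cong m (ℤpoly≗toℤi⟦⟧ p) k ⟩
    oneMinusβ^ m (toℤi ∘ ⟦ p ⟧) k               ≡⟨ oneMinusβ^-toℤi m ⟦ p ⟧ k ⟩
    toℤi (∇^ m ⟦ p ⟧ k)                         ≡⟨ cong toℤi (∇ᵐp≗∇ⁿT k) ⟩
    toℤi (∇^ n T k)                             ≡⟨ oneMinusβ^-toℤi n T k ⟨
    oneMinusβ^ n (toℤi ∘ T) k                   ≡⟨ oneMinusβ^-cong n (θ-coeff≡signedGF G) k ⟨
    oneMinusβ^ n (θ-coeff G) k                  ∎
  where
  open ≡-Reasoning
  T : Seq
  T = signedGF (degreeProduct G)
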